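{- For any ordered $r$-tuple $(i_1,\ldots,i_r)$ of nonnegative integers and any prime $p$, $$\nu_p\Big(\sum_j i_j\Big)\le\nu_p\Big(\sum_j i_j\,j\Big)+\nu_p\binom{\sum_j i_j}{i_1,\ldots,i_r}.$$
   Context: $\nu_p(q)$ denotes the exponent of the prime $p$ in a rational number $q$. The multinomial coefficient is $\binom{\sum_j i_j}{i_1,\ldots,i_r}:=\frac{(i_1+\cdots+i_r)!}{i_1!\cdots i_r!}$. -}

module Defs where

open import Data.Nat using (ℕ; zero; suc; _+_; _*_; _^_; _/_; _!; NonZero)
open import Data.Nat.Properties using (_!≢0; m*n≢0)
open import Data.Nat.Divisibility using (_∣_)

open import Data.Fin using (Fin; zero; suc)
open import Data.Product using (_×_)
open import Relation.Nullary using (¬_)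

-- sum of the entries of an r-tuple (i_1,...,i_r), indexed by Fin r (j = toℕ index + 1)
sumF : ∀ {r} → (Fin r → ℕ) → ℕ
sumF {zero}  i = 0
sumF {suc r} i = i zero + sumF (λ j → i (suc j))

prodFact : ∀ {r} → (Fin r → ℕ) → ℕ
prodFact {zero}  i = 1
prodFact {suc r} i = i zero ! * prodFact (λ j → i (suc j))

prodFact≢0 : ∀ {r} (i : Fin r → ℕ) → NonZero (prodFact i)
prodFact≢0 {zero}  i = _
prodFact≢0 {suc r} i =
  m*n≢0 (i zero !) (prodFact (λ j → i (suc j)))
    {{i zero !≢0}} {{prodFact≢0 (λ j → i (suc j))}}

multinomial : ∀ {r} → (Fin r → ℕ) → ℕ
multinomial i = (sumF i !) / prodFact i
  where instance _ = prodFact≢0 i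

-- ν_p(n) = k : p^k divides n but p^(k+1) does not.
-- (For n = 0 no such k exists, matching ν_p(0) = ∞.)
IsValuation : ℕ → ℕ → ℕ → Set
IsValuation p n k = (p ^ k ∣ n) × ¬ (p ^ suc k ∣ n)

module Submission where

-- Let n = i₁ + ⋯ + iᵣ and M = n! / (i₁! ⋯ iᵣ!) be the multinomial coefficient.
-- The argument is the p-adic shadow of the absorption identity
--     M · i_j = n · M⁽ʲ⁾,
-- where M⁽ʲ⁾ is the multinomial coefficient of the tuple with i_j lowered by one
-- (both sides equal n! / (i₁! ⋯ (i_j - 1)! ⋯ iᵣ!)).  Hence n divides M · i_j for
-- every j, so n divides M · Σ_j i_j j.  If p^a exactly divides n, then p^a divides
-- the product M · Σ_j i_j j, whose p-adic valuation is ν_p(M) + ν_p(Σ_j i_j j);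
-- therefore a ≤ ν_p(Σ_j i_j j) + ν_p(M).

open import Defs
open import Data.Nat using (ℕ; zero; suc; pred; _+_; _*_; _≤_; _<_; _^_; _∸_; _!; NonZero)
open import Data.Nat.Properties
open import Data.Nat.Divisibility
open import Data.Nat.DivMod using (m/n*n≡m)
open import Data.Nat.Combinatorics using (k![n∸k]!∣n!)
open import Data.Nat.Primality using (Prime; euclidsLemma; prime⇒nonZero)
open import Data.Nat.Tactic.RingSolver using (solve-∀)
open import Algebra.Properties.CommutativeSemigroup *-commutativeSemigroup using (x∙yz≈y∙xz)
open import Data.Fin using (Fin; toℕ; zero; suc)
open import Data.Vec.Functional using (updateAt)
open import Data.Product using (_,_)
open import Data.Sum using (inj₁; inj₂)
open import Relation.Nullary using (¬_)
open import Function using (case_of_)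
open import Relation.Binary.PropositionalEquality
open ≡-Reasoning

tail : ∀ {r} → (Fin (suc r) → ℕ) → Fin r → ℕ
tail i j = i (suc j)

prodFact∣sumF! : ∀ {r} (i : Fin r → ℕ) → prodFact i ∣ sumF i !
prodFact∣sumF! {zero}  i = ∣-refl
prodFact∣sumF! {suc r} i =
  ∣-trans (*-monoʳ-∣ (i zero !) (prodFact∣sumF! (tail i))) binomial-integral
  where
  m = sumF (tail i)
  binomial-integral : i zero ! * m ! ∣ (i zero + m) !
  binomial-integral =
    subst (λ x → i zero ! * x ! ∣ (i zero + m) !) (m+n∸m≡n (i zero) m)
      (k![n∸k]!∣n! (m≤m+n (i zero) m))

multinomial*prodFact : ∀ {r} (i : Fin r → ℕ) → multinomial i * prodFact i ≡ sumF i !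
multinomial*prodFact i = m/n*n≡m {{prodFact≢0 i}} (prodFact∣sumF! i)

sumF-lowered : ∀ {r} (i : Fin r → ℕ) j {k} → i j ≡ suc k →
  sumF i ≡ suc (sumF (updateAt i j pred))
sumF-lowered {suc r} i zero    eq rewrite eq = refl
sumF-lowered {suc r} i (suc j) eq =
  trans (cong (i zero +_) (sumF-lowered (tail i) j eq)) (+-suc (i zero) _)

prodFact-lowered : ∀ {r} (i : Fin r → ℕ) j {k} → i j ≡ suc k →
  prodFact i ≡ suc k * prodFact (updateAt i j pred)
prodFact-lowered {suc r} i zero {k} eq rewrite eq = *-assoc (suc k) (k !) _
prodFact-lowered {suc r} i (suc j) {k} eq = begin
  i zero ! * prodFact (tail i)                             ≡⟨ cong (i zero ! *_) (prodFact-lowered (tail i) j eq) ⟩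
  i zero ! * (suc k * prodFact (updateAt (tail i) j pred)) ≡⟨ x∙yz≈y∙xz (i zero !) (suc k) _ ⟩
  suc k * (i zero ! * prodFact (updateAt (tail i) j pred)) ∎

-- Absorption identity: if i_j = k + 1 and n = Σ i, then
-- M(i) · (k + 1) = n · M(i with i_j lowered by one), both sides being
-- n! / (product of factorials of the lowered tuple).
multinomial-absorption : ∀ {r} (i : Fin r → ℕ) j {k} → i j ≡ suc k →
  multinomial i * suc k ≡ sumF i * multinomial (updateAt i j pred)
multinomial-absorption i j {k} eq =
  *-cancelʳ-≡ _ _ P′ {{prodFact≢0 i′}} (begin
    multinomial i * suc k * P′   ≡⟨ *-assoc (multinomial i) (suc k) P′ ⟩
    multinomial i * (suc k * P′) ≡⟨ cong (multinomial i *_) (prodFact-lowered i j eq) ⟨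
    multinomial i * prodFact i   ≡⟨ multinomial*prodFact i ⟩
    sumF i !                     ≡⟨ cong _! (sumF-lowered i j eq) ⟩
    suc n′ * n′ !                ≡⟨ cong (suc n′ *_) (multinomial*prodFact i′) ⟨
    suc n′ * (M′ * P′)           ≡⟨ *-assoc (suc n′) M′ P′ ⟨
    suc n′ * M′ * P′             ≡⟨ cong (λ x → x * M′ * P′) (sumF-lowered i j eq) ⟨
    sumF i * M′ * P′             ∎)
  where
  i′ = updateAt i j pred
  M′ = multinomial i′
  P′ = prodFact i′
  n′ = sumF i′

sumF∣multinomial*entry : ∀ {r} (i : Fin r → ℕ) j → sumF i ∣ multinomial i * i j
sumF∣multinomial*entry i j with i j in eq
... | zero  = subst (sumF i ∣_) (sym (*-zeroʳ (multinomial i))) (sumF i ∣0)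
... | suc k = divides (multinomial (updateAt i j pred))
  (trans (multinomial-absorption i j eq) (*-comm (sumF i) _))

∣-sumF : ∀ {r} {d} (g : Fin r → ℕ) → (∀ j → d ∣ g j) → d ∣ sumF g
∣-sumF {zero}  {d} g d∣g = d ∣0
∣-sumF {suc r}     g d∣g = ∣m∣n⇒∣m+n (d∣g zero) (∣-sumF (tail g) (λ j → d∣g (suc j)))

*-distribˡ-sumF : ∀ {r} m (g : Fin r → ℕ) → m * sumF g ≡ sumF (λ j → m * g j)
*-distribˡ-sumF {zero}  m g = *-zeroʳ m
*-distribˡ-sumF {suc r} m g =
  trans (*-distribˡ-+ m (g zero) _) (cong (m * g zero +_) (*-distribˡ-sumF m (tail g)))

sumF∣multinomial*weighted : ∀ {r} (i : Fin r → ℕ) (w : Fin r → ℕ) →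
  sumF i ∣ multinomial i * sumF (λ j → i j * w j)
sumF∣multinomial*weighted i w =
  subst (sumF i ∣_) (sym (*-distribˡ-sumF (multinomial i) (λ j → i j * w j)))
    (∣-sumF (λ j → multinomial i * (i j * w j)) divides-term)
  where
  divides-term : ∀ j → sumF i ∣ multinomial i * (i j * w j)
  divides-term j = subst (sumF i ∣_) (*-assoc (multinomial i) (i j) (w j))
    (∣m⇒∣m*n (w j) (sumF∣multinomial*entry i j))

^-mono-∣ : ∀ p {m n} → m ≤ n → p ^ m ∣ p ^ n
^-mono-∣ p {m} {n} m≤n = divides (p ^ (n ∸ m)) (begin
  p ^ n                 ≡⟨ cong (p ^_) (m+[n∸m]≡n m≤n) ⟨
  p ^ (m + (n ∸ m))     ≡⟨ ^-distribˡ-+-* p m (n ∸ m) ⟩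
  p ^ m * p ^ (n ∸ m)   ≡⟨ *-comm (p ^ m) _ ⟩
  p ^ (n ∸ m) * p ^ m   ∎)

regroup : ∀ m s x y → m * y * (s * x) ≡ m * s * (x * y)
regroup = solve-∀

valuation-cofactor : ∀ p b {s} → ¬ (p ^ suc b ∣ s * p ^ b) → ¬ (p ∣ s)
valuation-cofactor p b ¬p^[1+b]∣S p∣s = ¬p^[1+b]∣S (*-monoˡ-∣ (p ^ b) p∣s)

∣-cofactor : ∀ p n {x} .{{_ : NonZero p}} → p ^ suc n ∣ x * p ^ n → p ∣ x
∣-cofactor p n p^[1+n]∣xp^n =
  *-cancelʳ-∣ (p ^ n) {{m^n≢0 p n}} p^[1+n]∣xp^n

-- Writing
-- S = s · p^b and M = m · p^c with p ∤ s, m, the product is m s · p^(b+c), and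
-- p^(b+c+1) dividing it would force p ∣ m s, contradicting Euclid's lemma.
valuation-of-product : ∀ {p} → Prime p → ∀ {S M} a b c →
  IsValuation p S b → IsValuation p M c → p ^ a ∣ M * S → a ≤ b + c
valuation-of-product {p} pp a b c
  (divides s refl , ¬p^[1+b]∣S) (divides m refl , ¬p^[1+c]∣M) p^a∣MS =
  ≮⇒≥ λ b+c<a → case euclidsLemma m s pp (p∣ms b+c<a) of λ where
    (inj₁ p∣m) → valuation-cofactor p c ¬p^[1+c]∣M p∣m
    (inj₂ p∣s) → valuation-cofactor p b ¬p^[1+b]∣S p∣s
  where
  MS≡ms*p^[b+c] : m * p ^ c * (s * p ^ b) ≡ m * s * p ^ (b + c)
  MS≡ms*p^[b+c] = begin
    m * p ^ c * (s * p ^ b)   ≡⟨ regroup m s (p ^ b) (p ^ c) ⟩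
    m * s * (p ^ b * p ^ c)   ≡⟨ cong (m * s *_) (^-distribˡ-+-* p b c) ⟨
    m * s * p ^ (b + c)       ∎
  p∣ms : b + c < a → p ∣ m * s
  p∣ms b+c<a = ∣-cofactor p (b + c) {{prime⇒nonZero pp}}
    (subst (p ^ suc (b + c) ∣_) MS≡ms*p^[b+c] (∣-trans (^-mono-∣ p b+c<a) p^a∣MS))

corollary1p6 : (r : ℕ) (i : Fin r → ℕ) (p : ℕ) → Prime p →
    (a b c : ℕ) →
    IsValuation p (sumF i) a →
    IsValuation p (sumF (λ j → i j * suc (toℕ j))) b →
    IsValuation p (multinomial i) c →
    a ≤ b + c
corollary1p6 r i p pp a b c (p^a∣n , _) ν-weighted ν-multinomial =
  valuation-of-product pp a b c ν-weighted ν-multinomial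
    (∣-trans p^a∣n (sumF∣multinomial*weighted i (λ j → suc (toℕ j))))
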